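{- Let $q\in\mathbb{Q}$. Then there exists a (connected) graph $G$ such that $\iota(G)=q$.
   Context: All graphs are finite, simple, undirected. For a connected graph $G$ with vertices $v_1,\dots,v_n$, $D=(d(v_i,v_j))_{i,j}$ is its shortest-path distance matrix and $\vec 1$ the all-ones vector. A curvature potential is a vector $\vec x$ with $D\vec x=\vec 1$; $G$ is distance exceptional if it has no curvature potential. Let $X(G)=\{D\vec x:\vec x\in\mathbb{R}^n,\ \vec x^\top\vec 1=1\}$. If $G$ is distance exceptional or has a curvature potential $\vec x$ with $\vec 1^\top\vec x\ne 0$, then $X(G)\cap\mathbb{R}\vec 1$ is a single point, and the curvature index $\iota(G)\in\mathbb{R}$ is defined by $X(G)\cap\mathbb{R}\vec 1=\{\iota(G)\vec 1\}$; otherwise $\iota(G):=\infty$. The curvature index is defined only for connected graphs.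
   Formalization: Curvature potentials, the vectors $\vec x$ in the definition of $X(G)$, and the scalar multiples of the all-ones vector are taken over ℚ instead of ℝ. -}

module Defs where

open import Data.Nat using (ℕ; zero; suc; _<_; _≥_)
open import Data.Fin using (Fin; zero; suc)
open import Data.Bool using (Bool; true)
open import Data.Integer using (+_)
open import Data.Rational using (ℚ; 0ℚ; 1ℚ; _+_; _*_; _/_)
open import Data.Product using (Σ; ∃; _×_; _,_)
open import Data.Sum using (_⊎_)
open import Relation.Binary.PropositionalEquality using (_≡_; _≢_)
open import Relation.Nullary using (¬_)
open import Function.Bundles using (_⇔_)

record Graph : Set where
  field
    n      : ℕ
    adj    : Fin n → Fin n → Bool
    sym    : ∀ u v → adj u v ≡ adj v u
    irrefl : ∀ v → adj v v ≢ true
open Graph public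

data Walk (G : Graph) : Fin (n G) → Fin (n G) → ℕ → Set where
  nil  : ∀ v → Walk G v v zero
  cons : ∀ {u v w k} → adj G u v ≡ true → Walk G v w k → Walk G u w (suc k)

Connected : Graph → Set
Connected G = (n G ≥ 1) × (∀ u v → ∃ λ k → Walk G u v k)

IsDistance : (G : Graph) → Fin (n G) → Fin (n G) → ℕ → Set
IsDistance G u v k = Walk G u v k × (∀ m → m < k → ¬ Walk G u v m)

IsDistanceMatrix : (G : Graph) → (Fin (n G) → Fin (n G) → ℕ) → Set
IsDistanceMatrix G D = ∀ u v → IsDistance G u v (D u v)

Σℚ : ∀ {m} → (Fin m → ℚ) → ℚ
Σℚ {zero}  f = 0ℚ
Σℚ {suc m} f = f zero + Σℚ (λ i → f (suc i))

ℕ→ℚ : ℕ → ℚ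
ℕ→ℚ k = + k / 1

_·_ : ∀ {m} → (Fin m → Fin m → ℕ) → (Fin m → ℚ) → (Fin m → ℚ)
(D · x) i = Σℚ (λ j → ℕ→ℚ (D i j) * x j)

IsCurvaturePotential : ∀ {m} → (Fin m → Fin m → ℕ) → (Fin m → ℚ) → Set
IsCurvaturePotential D x = ∀ i → (D · x) i ≡ 1ℚ

DistanceExceptional : ∀ {m} → (Fin m → Fin m → ℕ) → Set
DistanceExceptional D = ¬ (∃ λ x → IsCurvaturePotential D x)

InX : ∀ {m} → (Fin m → Fin m → ℕ) → (Fin m → ℚ) → Set
InX D y = ∃ λ x → (Σℚ x ≡ 1ℚ) × (∀ i → (D · x) i ≡ y i)

-- ι = q (finite value): G is distance exceptional or has a curvature
-- potential with nonzero sum, and X(G) ∩ ℚ1 = { q 1 }.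
IndexOfMatrixIs : ∀ {m} → (Fin m → Fin m → ℕ) → ℚ → Set
IndexOfMatrixIs D q =
  (DistanceExceptional D ⊎ (∃ λ x → IsCurvaturePotential D x × (Σℚ x ≢ 0ℚ)))
  × (∀ c → InX D (λ _ → c) ⇔ (c ≡ q))

-- ι(G) = q for a graph G (distance matrix is unique when it exists).
CurvatureIndexIs : Graph → ℚ → Set
CurvatureIndexIs G q =
  Σ (Fin (n G) → Fin (n G) → ℕ) λ D → IsDistanceMatrix G D × IndexOfMatrixIs D q

{-# OPTIONS --safe #-}

-- K₁ has zero distance matrix, so ι(K₁) = 0. For q ≠ 0 take the complete multipartite graph with
-- 2 + k singleton parts and a parts of size m + 2. Its distance matrix is J + S − 2I, with S the
-- same-part indicator, so for y constant on parts (D y)ᵤ = 1ᵀy + (s − 2) yᵤ, s the size of u's part.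
-- With y = −m on singletons and 1 elsewhere this gives D y = (1ᵀy + m) 1, and since D is symmetric
-- ι = (1ᵀy + m) / 1ᵀy = 1 + m / (a (m + 2) − (k + 2) m). For q = p / Q the choices
-- m = 2 (p − Q), a = k = Q + m when q ≥ 1, and m = 2 (Q − p), a = e Q + m, k = (e + 1) Q + m with
-- e = Q − p − 1 when q < 1, make the denominator ±2Q, and then ι = q.

module Submission where

open import Defs
open import Algebra.Bundles using (CommutativeRing)
import Algebra.Properties.Group
import Algebra.Properties.Semiring.Sum
open import Data.Bool using (Bool; true; false; not; if_then_else_)
open import Data.Fin as Fin using (Fin; zero; suc; splitAt)
import Data.Integer as ℤ
import Data.Integer.Properties as ℤ
open import Data.List using (List; []; _∷_; _++_; replicate; length)
open import Data.Nat.ListAction using (sum)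
open import Data.List.Relation.Unary.All using (All; []; _∷_)
open import Data.List.Relation.Unary.All.Properties using (++⁺; replicate⁺)
open import Data.Nat as ℕ using (ℕ; zero; suc; z≤n; s≤s; _≥_)
open import Data.Nat.Properties using (m+[n∸m]≡n; ≰⇒>; +-suc; *-distribˡ-+)
open import Data.Nat.Tactic.RingSolver using (solve-∀)
import Data.Nat.Coprimality as Coprime
open import Data.Product using (Σ; ∃; ∃₂; _×_; _,_; proj₁; proj₂)
open import Data.Rational as ℚ using (ℚ; mkℚ; 0ℚ; 1ℚ; _+_; _*_; -_; _-_; 1/_; toℚᵘ)
open import Data.Rational.Properties
  using ( _≟_; 1≢0; +-*-commutativeRing; normalize-coprime; toℚᵘ-injective
        ; toℚᵘ-homo-+; toℚᵘ-homo-*; +-identityˡ; +-identityʳ; +-assoc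
        ; *-identityˡ; *-identityʳ; *-assoc; *-comm; *-zeroˡ; *-zeroʳ; *-inverseˡ; neg-injective)
import Data.Rational.Unnormalised as ℚᵘ
open import Data.Rational.Unnormalised.Properties using (≃-trans; ≃-sym)
open import Data.Rational.Solver using (module +-*-Solver)
open import Data.Sum using (_⊎_; inj₁; inj₂; [_,_]′; map₁)
open import Function using (_∘_; const)
open import Function.Bundles using (mk⇔)
open import Relation.Binary.PropositionalEquality as ≡ using (_≡_; _≢_; refl; cong; cong₂; trans; subst)
open import Relation.Nullary using (¬_; does; yes; no; contradiction)
open import Relation.Nullary.Decidable using (dec-true; dec-false)

open +-*-Solver
open ≡.≡-Reasoning

open Algebra.Properties.Semiring.Sum (CommutativeRing.semiring +-*-commutativeRing)
  using (sum-cong-≗; ∑-distrib-+; ∑-comm; *-distribˡ-sum; sum-replicate-zero)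
  renaming (sum to ∑)
open Algebra.Properties.Group (CommutativeRing.+-group +-*-commutativeRing) using (∙-cancelʳ)

toℚᵘ-ℕ→ℚ : ∀ k → toℚᵘ (ℕ→ℚ k) ≡ ℚᵘ.mkℚᵘ (ℤ.+ k) 0
toℚᵘ-ℕ→ℚ k = cong toℚᵘ (normalize-coprime (Coprime.sym (Coprime.1-coprimeTo k)))

ℕ→ℚ-+ : ∀ a b → ℕ→ℚ (a ℕ.+ b) ≡ ℕ→ℚ a + ℕ→ℚ b
ℕ→ℚ-+ a b = toℚᵘ-injective (≃-trans cast (≃-sym (toℚᵘ-homo-+ (ℕ→ℚ a) (ℕ→ℚ b))))
  where
  cast : toℚᵘ (ℕ→ℚ (a ℕ.+ b)) ℚᵘ.≃ toℚᵘ (ℕ→ℚ a) ℚᵘ.+ toℚᵘ (ℕ→ℚ b)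
  cast rewrite toℚᵘ-ℕ→ℚ a | toℚᵘ-ℕ→ℚ b | toℚᵘ-ℕ→ℚ (a ℕ.+ b) =
    ℚᵘ.*≡* (cong (ℤ._* ℤ.+ 1)
                 (cong₂ ℤ._+_ (≡.sym (ℤ.*-identityʳ (ℤ.+ a))) (≡.sym (ℤ.*-identityʳ (ℤ.+ b)))))

ℕ→ℚ-* : ∀ a b → ℕ→ℚ (a ℕ.* b) ≡ ℕ→ℚ a * ℕ→ℚ b
ℕ→ℚ-* a b = toℚᵘ-injective (≃-trans cast (≃-sym (toℚᵘ-homo-* (ℕ→ℚ a) (ℕ→ℚ b))))
  where
  cast : toℚᵘ (ℕ→ℚ (a ℕ.* b)) ℚᵘ.≃ toℚᵘ (ℕ→ℚ a) ℚᵘ.* toℚᵘ (ℕ→ℚ b)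
  cast rewrite toℚᵘ-ℕ→ℚ a | toℚᵘ-ℕ→ℚ b | toℚᵘ-ℕ→ℚ (a ℕ.* b) =
    ℚᵘ.*≡* (cong (ℤ._* ℤ.+ 1) (≡.sym (ℤ.+◃n≡+n (a ℕ.* b))))

ℕ→ℚ-≢0 : ∀ k .{{_ : ℕ.NonZero k}} → ℕ→ℚ k ≢ 0ℚ
ℕ→ℚ-≢0 (suc k) eq with () ← trans (≡.sym (toℚᵘ-ℕ→ℚ (suc k))) (cong toℚᵘ eq)

mkℚ-*-denominator : ∀ p Q .{c : Coprime.Coprime p (suc Q)} →
                    mkℚ (ℤ.+ p) Q c * ℕ→ℚ (suc Q) ≡ ℕ→ℚ p
mkℚ-*-denominator p Q {c} =
  toℚᵘ-injective (≃-trans (toℚᵘ-homo-* (mkℚ (ℤ.+ p) Q c) (ℕ→ℚ (suc Q))) cast)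
  where
  cast : toℚᵘ (mkℚ (ℤ.+ p) Q c) ℚᵘ.* toℚᵘ (ℕ→ℚ (suc Q)) ℚᵘ.≃ toℚᵘ (ℕ→ℚ p)
  cast rewrite toℚᵘ-ℕ→ℚ p | toℚᵘ-ℕ→ℚ (suc Q) =
    ℚᵘ.*≡* (ℤ.*-assoc (ℤ.+ p) (ℤ.+ suc Q) (ℤ.+ 1))

ℕ→ℚ-difference : ∀ {x} y z → x ≡ y ℕ.+ z → ℕ→ℚ x - ℕ→ℚ y ≡ ℕ→ℚ z
ℕ→ℚ-difference y z refl =
  trans (cong (_- ℕ→ℚ y) (ℕ→ℚ-+ y z))
        (solve 2 (λ y z → (y :+ z) :- y := z) refl (ℕ→ℚ y) (ℕ→ℚ z))

ℕ→ℚ-difference⁻ : ∀ x {y} z → y ≡ x ℕ.+ z → ℕ→ℚ x - ℕ→ℚ y ≡ - ℕ→ℚ z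
ℕ→ℚ-difference⁻ x z refl =
  trans (cong (λ t → ℕ→ℚ x - t) (ℕ→ℚ-+ x z))
        (solve 2 (λ x z → x :- (x :+ z) := :- z) refl (ℕ→ℚ x) (ℕ→ℚ z))

*-≢0 : ∀ {p r} → p ≢ 0ℚ → r ≢ 0ℚ → p * r ≢ 0ℚ
*-≢0 {p} {r} p≢0 r≢0 pr≡0 = r≢0 (begin
  r                ≡⟨ *-identityˡ r ⟨
  1ℚ * r           ≡⟨ cong (_* r) (*-inverseˡ p) ⟨
  (1/ p * p) * r   ≡⟨ *-assoc (1/ p) p r ⟩
  1/ p * (p * r)   ≡⟨ cong (1/ p *_) pr≡0 ⟩
  1/ p * 0ℚ        ≡⟨ *-zeroʳ (1/ p) ⟩
  0ℚ               ∎)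
  where
  instance
    p-nonZero : ℚ.NonZero p
    p-nonZero = ℚ.≢-nonZero p≢0

Σℚ≡∑ : ∀ {m} (f : Fin m → ℚ) → Σℚ f ≡ ∑ f
Σℚ≡∑ {zero}  f = refl
Σℚ≡∑ {suc m} f = cong (f zero +_) (Σℚ≡∑ (f ∘ suc))

Σ-cong : ∀ {m} {f g : Fin m → ℚ} → (∀ i → f i ≡ g i) → Σℚ f ≡ Σℚ g
Σ-cong {f = f} {g} f≗g = begin
  Σℚ f ≡⟨ Σℚ≡∑ f ⟩
  ∑ f  ≡⟨ sum-cong-≗ f≗g ⟩
  ∑ g  ≡⟨ Σℚ≡∑ g ⟨
  Σℚ g ∎

Σ-zero : ∀ m → Σℚ {m} (const 0ℚ) ≡ 0ℚ
Σ-zero m = trans (Σℚ≡∑ {m} (const 0ℚ)) (sum-replicate-zero m)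

Σ-+ : ∀ {m} (f g : Fin m → ℚ) → Σℚ (λ i → f i + g i) ≡ Σℚ f + Σℚ g
Σ-+ f g = begin
  Σℚ (λ i → f i + g i) ≡⟨ Σℚ≡∑ (λ i → f i + g i) ⟩
  ∑ (λ i → f i + g i)  ≡⟨ ∑-distrib-+ f g ⟩
  ∑ f + ∑ g            ≡⟨ cong₂ _+_ (Σℚ≡∑ f) (Σℚ≡∑ g) ⟨
  Σℚ f + Σℚ g          ∎

Σ-*ˡ : ∀ {m} c (f : Fin m → ℚ) → Σℚ (λ i → c * f i) ≡ c * Σℚ f
Σ-*ˡ c f = begin
  Σℚ (λ i → c * f i) ≡⟨ Σℚ≡∑ (λ i → c * f i) ⟩
  ∑ (λ i → c * f i)  ≡⟨ *-distribˡ-sum c f ⟨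
  c * ∑ f            ≡⟨ cong (c *_) (Σℚ≡∑ f) ⟨
  c * Σℚ f           ∎

Σ-comm : ∀ {m p} (F : Fin m → Fin p → ℚ) →
         Σℚ (λ i → Σℚ (λ j → F i j)) ≡ Σℚ (λ j → Σℚ (λ i → F i j))
Σ-comm F = begin
  Σℚ (λ i → Σℚ (λ j → F i j)) ≡⟨ Σ-cong (λ i → Σℚ≡∑ (F i)) ⟩
  Σℚ (λ i → ∑ (λ j → F i j))  ≡⟨ Σℚ≡∑ (λ i → ∑ (F i)) ⟩
  ∑ (λ i → ∑ (λ j → F i j))   ≡⟨ ∑-comm F ⟩
  ∑ (λ j → ∑ (λ i → F i j))   ≡⟨ Σℚ≡∑ (λ j → ∑ (λ i → F i j)) ⟨
  Σℚ (λ j → ∑ (λ i → F i j))  ≡⟨ Σ-cong (λ j → Σℚ≡∑ (λ i → F i j)) ⟨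
  Σℚ (λ j → Σℚ (λ i → F i j)) ∎

Σ-const : ∀ m c → Σℚ {m} (const c) ≡ ℕ→ℚ m * c
Σ-const zero    c = ≡.sym (*-zeroˡ c)
Σ-const (suc m) c = begin
  c + Σℚ {m} (const c)    ≡⟨ cong (c +_) (Σ-const m c) ⟩
  c + ℕ→ℚ m * c           ≡⟨ solve 2 (λ c x → c :+ x :* c := (con 1ℚ :+ x) :* c) refl c (ℕ→ℚ m) ⟩
  (1ℚ + ℕ→ℚ m) * c        ≡⟨ cong (_* c) (ℕ→ℚ-+ 1 m) ⟨
  ℕ→ℚ (suc m) * c         ∎

Σ-δ : ∀ {m} (u : Fin m) (f : Fin m → ℚ) → Σℚ (λ v → if does (u Fin.≟ v) then f v else 0ℚ) ≡ f u
Σ-δ {suc m} zero    f = trans (cong (f zero +_) (Σ-zero m)) (+-identityʳ (f zero))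
Σ-δ         (suc u) f = trans (+-identityˡ _) (Σ-δ u (f ∘ suc))

Σ-splitAt : ∀ s {t} (h : Fin s ⊎ Fin t → ℚ) →
            Σℚ (h ∘ splitAt s) ≡ Σℚ (h ∘ inj₁) + Σℚ (h ∘ inj₂)
Σ-splitAt zero    h = ≡.sym (+-identityˡ _)
Σ-splitAt (suc s) h = begin
  h₀ + Σℚ (h ∘ map₁ suc ∘ splitAt s)          ≡⟨ cong (h₀ +_) (Σ-splitAt s (h ∘ map₁ suc)) ⟩
  h₀ + (Σℚ (h ∘ inj₁ ∘ suc) + Σℚ (h ∘ inj₂))  ≡⟨ +-assoc h₀ (Σℚ (h ∘ inj₁ ∘ suc)) (Σℚ (h ∘ inj₂)) ⟨
  (h₀ + Σℚ (h ∘ inj₁ ∘ suc)) + Σℚ (h ∘ inj₂)  ∎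
  where
  h₀ : ℚ
  h₀ = h (inj₁ zero)

·-scale : ∀ {N} (D : Fin N → Fin N → ℕ) c y i → (D · (λ j → c * y j)) i ≡ c * (D · y) i
·-scale D c y i = trans (Σ-cong reassociate) (Σ-*ˡ c (λ j → ℕ→ℚ (D i j) * y j))
  where
  reassociate : ∀ j → ℕ→ℚ (D i j) * (c * y j) ≡ c * (ℕ→ℚ (D i j) * y j)
  reassociate j = solve 3 (λ d c y → d :* (c :* y) := c :* (d :* y)) refl (ℕ→ℚ (D i j)) c (y j)

·-selfAdjoint : ∀ {N} {D : Fin N → Fin N → ℕ} → (∀ i j → D i j ≡ D j i) →
                ∀ x y → Σℚ (λ i → x i * (D · y) i) ≡ Σℚ (λ j → y j * (D · x) j)
·-selfAdjoint {D = D} D-sym x y = begin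
  Σℚ (λ i → x i * (D · y) i)
    ≡⟨ Σ-cong (λ i → Σ-*ˡ (x i) (λ j → ℕ→ℚ (D i j) * y j)) ⟨
  Σℚ (λ i → Σℚ (λ j → x i * (ℕ→ℚ (D i j) * y j)))
    ≡⟨ Σ-comm (λ i j → x i * (ℕ→ℚ (D i j) * y j)) ⟩
  Σℚ (λ j → Σℚ (λ i → x i * (ℕ→ℚ (D i j) * y j)))
    ≡⟨ Σ-cong (λ j → Σ-cong (swap j)) ⟩
  Σℚ (λ j → Σℚ (λ i → y j * (ℕ→ℚ (D j i) * x i)))
    ≡⟨ Σ-cong (λ j → Σ-*ˡ (y j) (λ i → ℕ→ℚ (D j i) * x i)) ⟩
  Σℚ (λ j → y j * (D · x) j)
    ∎
  where
  swap : ∀ j i → x i * (ℕ→ℚ (D i j) * y j) ≡ y j * (ℕ→ℚ (D j i) * x i)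
  swap j i rewrite D-sym i j =
    solve 3 (λ x d y → x :* (d :* y) := y :* (d :* x)) refl (x i) (ℕ→ℚ (D j i)) (y j)

potential⇒index : ∀ {N} {D : Fin N → Fin N → ℕ} → (∀ i j → D i j ≡ D j i) →
                   ∀ {x} q → IsCurvaturePotential D x → q * Σℚ x ≡ 1ℚ → IndexOfMatrixIs D q
potential⇒index {D = D} D-sym {x} q Dx≡1 qΣx≡1 =
  inj₂ (x , Dx≡1 , Σx≢0) , λ c → mk⇔ (onlyIf c) (if c)
  where
  Σx≢0 : Σℚ x ≢ 0ℚ
  Σx≢0 Σx≡0 = 1≢0 (begin
    1ℚ         ≡⟨ qΣx≡1 ⟨
    q * Σℚ x   ≡⟨ cong (q *_) Σx≡0 ⟩
    q * 0ℚ     ≡⟨ *-zeroʳ q ⟩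
    0ℚ         ∎)

  onlyIf : ∀ c → InX D (λ _ → c) → c ≡ q
  onlyIf c (z , Σz≡1 , Dz≡c) = begin
    c                ≡⟨ trans (cong (c *_) qΣx≡1) (*-identityʳ c) ⟨
    c * (q * Σℚ x)   ≡⟨ solve 3 (λ c q s → c :* (q :* s) := q :* (c :* s)) refl c q (Σℚ x) ⟩
    q * (c * Σℚ x)   ≡⟨ cong (q *_) cΣx≡1 ⟩
    q * 1ℚ           ≡⟨ *-identityʳ q ⟩
    q                ∎
    where
    cΣx≡1 : c * Σℚ x ≡ 1ℚ
    cΣx≡1 = begin
      c * Σℚ x                   ≡⟨ Σ-*ˡ c x ⟨
      Σℚ (λ i → c * x i)         ≡⟨ Σ-cong (λ i → trans (*-comm c (x i)) (cong (x i *_) (≡.sym (Dz≡c i)))) ⟩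
      Σℚ (λ i → x i * (D · z) i) ≡⟨ ·-selfAdjoint D-sym x z ⟩
      Σℚ (λ j → z j * (D · x) j) ≡⟨ Σ-cong (λ j → trans (cong (z j *_) (Dx≡1 j)) (*-identityʳ (z j))) ⟩
      Σℚ z                       ≡⟨ Σz≡1 ⟩
      1ℚ                         ∎

  if : ∀ c → c ≡ q → InX D (λ _ → c)
  if c refl = (λ i → q * x i) , trans (Σ-*ˡ q x) qΣx≡1 ,
              λ i → trans (·-scale D q x i) (trans (cong (q *_) (Dx≡1 i)) (*-identityʳ q))

constantRows⇒index : ∀ {N} {D : Fin N → Fin N → ℕ} → (∀ i j → D i j ≡ D j i) →
                      ∀ {y} c q → c ≢ 0ℚ → (∀ i → (D · y) i ≡ c) → q * Σℚ y ≡ c →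
                      IndexOfMatrixIs D q
constantRows⇒index {D = D} D-sym {y} c q c≢0 Dy≡c qΣy≡c =
  potential⇒index D-sym q potential normalised
  where
  instance
    c-nonZero : ℚ.NonZero c
    c-nonZero = ℚ.≢-nonZero c≢0

  potential : IsCurvaturePotential D (λ j → 1/ c * y j)
  potential i = trans (·-scale D (1/ c) y i) (trans (cong (1/ c *_) (Dy≡c i)) (*-inverseˡ c))

  normalised : q * Σℚ (λ j → 1/ c * y j) ≡ 1ℚ
  normalised = begin
    q * Σℚ (λ j → 1/ c * y j)  ≡⟨ cong (q *_) (Σ-*ˡ (1/ c) y) ⟩
    q * (1/ c * Σℚ y)          ≡⟨ solve 3 (λ q i s → q :* (i :* s) := i :* (q :* s)) refl q (1/ c) (Σℚ y) ⟩
    1/ c * (q * Σℚ y)          ≡⟨ cong (1/ c *_) qΣy≡c ⟩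
    1/ c * c                   ≡⟨ *-inverseˡ c ⟩
    1ℚ                         ∎

connected : ∀ {G D} → n G ≥ 1 → IsDistanceMatrix G D → Connected G
connected {D = D} n≥1 D-dist = n≥1 , λ u v → D u v , proj₁ (D-dist u v)

Walk-0⇒≡ : ∀ {G u v} → Walk G u v 0 → u ≡ v
Walk-0⇒≡ (nil _) = refl

Walk-1⇒adj : ∀ {G u v} → Walk G u v 1 → adj G u v ≡ true
Walk-1⇒adj (cons uv (nil _)) = uv

module CompleteMultipartite {N K : ℕ} (part : Fin N → Fin K) where

  samePart : Fin N → Fin N → Bool
  samePart u v = does (part u Fin.≟ part v)

  samePart-sym : ∀ u v → samePart u v ≡ samePart v u
  samePart-sym u v with part u Fin.≟ part v
  ... | yes same   = ≡.sym (dec-true (part v Fin.≟ part u) (≡.sym same))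
  ... | no  differ = ≡.sym (dec-false (part v Fin.≟ part u) (differ ∘ ≡.sym))

  samePart-refl : ∀ v → samePart v v ≡ true
  samePart-refl v = dec-true (part v Fin.≟ part v) refl

  graph : Graph
  graph = record
    { n      = N
    ; adj    = λ u v → not (samePart u v)
    ; sym    = λ u v → cong not (samePart-sym u v)
    ; irrefl = λ v → subst (λ b → not b ≢ true) (≡.sym (samePart-refl v)) (λ ())
    }

  adj-≢ : ∀ {u v} → part u ≢ part v → adj graph u v ≡ true
  adj-≢ {u} {v} differ = cong not (dec-false (part u Fin.≟ part v) differ)

  adj⇒≢ : ∀ {u v} → adj graph u v ≡ true → part u ≢ part v
  adj⇒≢ {u} {v} uv same with () ← trans (≡.sym uv) (cong not (dec-true (part u Fin.≟ part v) same))

  distance : Fin N → Fin N → ℕ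
  distance u v = if does (u Fin.≟ v) then 0 else if samePart u v then 2 else 1

  distance-sym : ∀ u v → distance u v ≡ distance v u
  distance-sym u v with u Fin.≟ v | v Fin.≟ u
  ... | yes refl | yes _    = refl
  ... | yes refl | no  v≢v  = contradiction refl v≢v
  ... | no  u≢u  | yes refl = contradiction refl u≢u
  ... | no  _    | no  _    = cong (λ b → if b then 2 else 1) (samePart-sym u v)

  isDistanceMatrix : (∀ u → ∃ λ w → part u ≢ part w) → IsDistanceMatrix graph distance
  isDistanceMatrix other u v with u Fin.≟ v | part u Fin.≟ part v
  ... | yes refl | _ = nil u , λ _ ()
  ... | no u≢v | yes same = cons (adj-≢ u≁w) (cons (adj-≢ w≁v) (nil v)) , noShorter
    where
    w : Fin N
    w = proj₁ (other u)
    u≁w : part u ≢ part w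
    u≁w = proj₂ (other u)
    w≁v : part w ≢ part v
    w≁v w∼v = u≁w (trans same (≡.sym w∼v))
    noShorter : ∀ k → k ℕ.< 2 → ¬ Walk graph u v k
    noShorter zero          _                   walk = u≢v (Walk-0⇒≡ walk)
    noShorter (suc zero)    _                   walk = adj⇒≢ (Walk-1⇒adj walk) same
    noShorter (suc (suc _)) (s≤s (s≤s ()))      _
  ... | no u≢v | no differ = cons (adj-≢ differ) (nil v) , noShorter
    where
    noShorter : ∀ k → k ℕ.< 1 → ¬ Walk graph u v k
    noShorter zero    _         walk = u≢v (Walk-0⇒≡ walk)
    noShorter (suc _) (s≤s ())  _

  ·-distance : ∀ y u → (distance · y) u + ℕ→ℚ 2 * y u
                       ≡ Σℚ y + Σℚ (λ v → if samePart u v then y v else 0ℚ)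
  ·-distance y u = begin
    (distance · y) u + ℕ→ℚ 2 * y u
      ≡⟨ cong ((distance · y) u +_) (Σ-δ u (λ v → ℕ→ℚ 2 * y v)) ⟨
    (distance · y) u + Σℚ (λ v → if does (u Fin.≟ v) then ℕ→ℚ 2 * y v else 0ℚ)
      ≡⟨ Σ-+ (λ v → ℕ→ℚ (distance u v) * y v)
             (λ v → if does (u Fin.≟ v) then ℕ→ℚ 2 * y v else 0ℚ) ⟨
    Σℚ (λ v → ℕ→ℚ (distance u v) * y v + (if does (u Fin.≟ v) then ℕ→ℚ 2 * y v else 0ℚ))
      ≡⟨ Σ-cong entry ⟩
    Σℚ (λ v → y v + (if samePart u v then y v else 0ℚ))
      ≡⟨ Σ-+ y (λ v → if samePart u v then y v else 0ℚ) ⟩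
    Σℚ y + Σℚ (λ v → if samePart u v then y v else 0ℚ)
      ∎
    where
    entry : ∀ v → ℕ→ℚ (distance u v) * y v + (if does (u Fin.≟ v) then ℕ→ℚ 2 * y v else 0ℚ)
                ≡ y v + (if samePart u v then y v else 0ℚ)
    entry v with u Fin.≟ v | part u Fin.≟ part v
    ... | yes refl | no differ = contradiction refl differ
    ... | yes refl | yes _ = solve 1 (λ y → con 0ℚ :* y :+ con (ℕ→ℚ 2) :* y := y :+ y) refl (y v)
    ... | no _     | yes _ = solve 1 (λ y → con (ℕ→ℚ 2) :* y :+ con 0ℚ := y :+ y) refl (y v)
    ... | no _     | no _  = solve 1 (λ y → con 1ℚ :* y :+ con 0ℚ := y :+ con 0ℚ) refl (y v)

partIndex : (ns : List ℕ) → Fin (sum ns) → Fin (length ns)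
partIndex (s ∷ ns) = [ const zero , suc ∘ partIndex ns ]′ ∘ splitAt s

partSize : (ns : List ℕ) → Fin (sum ns) → ℕ
partSize (s ∷ ns) = [ const s , partSize ns ]′ ∘ splitAt s

partSize-All : ∀ {P : ℕ → Set} {ns} → All P ns → ∀ v → P (partSize ns v)
partSize-All {P} {s ∷ ns} (Ps ∷ Pns) v = onSplit (splitAt s v)
  where
  onSplit : ∀ x → P ([ const s , partSize ns ]′ x)
  onSplit (inj₁ _) = Ps
  onSplit (inj₂ j) = partSize-All Pns j

Σ-samePart : ∀ ns (g : ℕ → ℚ) u →
  Σℚ (λ v → if does (partIndex ns u Fin.≟ partIndex ns v) then g (partSize ns v) else 0ℚ)
    ≡ ℕ→ℚ (partSize ns u) * g (partSize ns u)
Σ-samePart (s ∷ ns) g u = trans (Σ-splitAt s (summand (splitAt s u))) (split (splitAt s u))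
  where
  index : Fin s ⊎ Fin (sum ns) → Fin (length (s ∷ ns))
  index = [ const zero , suc ∘ partIndex ns ]′

  size : Fin s ⊎ Fin (sum ns) → ℕ
  size = [ const s , partSize ns ]′

  summand : Fin s ⊎ Fin (sum ns) → Fin s ⊎ Fin (sum ns) → ℚ
  summand x z = if does (index x Fin.≟ index z) then g (size z) else 0ℚ

  split : ∀ x → Σℚ (summand x ∘ inj₁) + Σℚ (summand x ∘ inj₂) ≡ ℕ→ℚ (size x) * g (size x)
  split (inj₁ _) = begin
    Σℚ {s} (const (g s)) + Σℚ {sum ns} (const 0ℚ)  ≡⟨ cong₂ _+_ (Σ-const s (g s)) (Σ-zero (sum ns)) ⟩
    ℕ→ℚ s * g s + 0ℚ                               ≡⟨ +-identityʳ _ ⟩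
    ℕ→ℚ s * g s                                    ∎
  split (inj₂ j) = begin
    Σℚ {s} (const 0ℚ) + rest                  ≡⟨ cong (_+ rest) (Σ-zero s) ⟩
    0ℚ + rest                                 ≡⟨ +-identityˡ rest ⟩
    rest                                      ≡⟨ Σ-samePart ns g j ⟩
    ℕ→ℚ (partSize ns j) * g (partSize ns j)   ∎
    where
    rest : ℚ
    rest = Σℚ (summand (inj₂ j) ∘ inj₂)

Σ-parts : List ℕ → (ℕ → ℚ) → ℚ
Σ-parts []       g = 0ℚ
Σ-parts (s ∷ ns) g = ℕ→ℚ s * g s + Σ-parts ns g

Σ-partSize : ∀ ns (g : ℕ → ℚ) → Σℚ (g ∘ partSize ns) ≡ Σ-parts ns g
Σ-partSize []       g = refl
Σ-partSize (s ∷ ns) g = trans (Σ-splitAt s (g ∘ [ const s , partSize ns ]′))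
                              (cong₂ _+_ (Σ-const s (g s)) (Σ-partSize ns g))

Σ-parts-++ : ∀ xs ys g → Σ-parts (xs ++ ys) g ≡ Σ-parts xs g + Σ-parts ys g
Σ-parts-++ []       ys g = ≡.sym (+-identityˡ _)
Σ-parts-++ (x ∷ xs) ys g = trans (cong (ℕ→ℚ x * g x +_) (Σ-parts-++ xs ys g))
                                 (≡.sym (+-assoc (ℕ→ℚ x * g x) (Σ-parts xs g) (Σ-parts ys g)))

Σ-parts-replicate : ∀ r s g → Σ-parts (replicate r s) g ≡ ℕ→ℚ r * (ℕ→ℚ s * g s)
Σ-parts-replicate r s g = trans (asConstantSum r) (Σ-const r (ℕ→ℚ s * g s))
  where
  asConstantSum : ∀ r → Σ-parts (replicate r s) g ≡ Σℚ {r} (const (ℕ→ℚ s * g s))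
  asConstantSum zero    = refl
  asConstantSum (suc r) = cong (ℕ→ℚ s * g s +_) (asConstantSum r)

module Family (m a k : ℕ) where

  parts : List ℕ
  parts = 1 ∷ 1 ∷ replicate k 1 ++ replicate a (2 ℕ.+ m)

  open CompleteMultipartite (partIndex parts) public

  otherPart : ∀ u → ∃ λ w → partIndex parts u ≢ partIndex parts w
  otherPart zero    = suc zero , λ ()
  otherPart (suc u) = zero , λ ()

  weight : ℕ → ℚ
  weight s = if s ℕ.≡ᵇ 1 then - ℕ→ℚ m else 1ℚ

  weight-balanced : All (λ s → ℕ→ℚ s * weight s ≡ ℕ→ℚ 2 * weight s + ℕ→ℚ m) parts
  weight-balanced = singleton ∷ singleton ∷ ++⁺ (replicate⁺ k singleton) (replicate⁺ a big)
    where
    singleton : ℕ→ℚ 1 * weight 1 ≡ ℕ→ℚ 2 * weight 1 + ℕ→ℚ m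
    singleton = solve 1 (λ M → con 1ℚ :* (:- M) := con (ℕ→ℚ 2) :* (:- M) :+ M) refl (ℕ→ℚ m)
    big : ℕ→ℚ (2 ℕ.+ m) * weight (2 ℕ.+ m) ≡ ℕ→ℚ 2 * weight (2 ℕ.+ m) + ℕ→ℚ m
    big = begin
      ℕ→ℚ (2 ℕ.+ m) * 1ℚ      ≡⟨ *-identityʳ _ ⟩
      ℕ→ℚ (2 ℕ.+ m)           ≡⟨ ℕ→ℚ-+ 2 m ⟩
      ℕ→ℚ 2 + ℕ→ℚ m         ≡⟨ cong (_+ ℕ→ℚ m) (*-identityʳ (ℕ→ℚ 2)) ⟨
      ℕ→ℚ 2 * 1ℚ + ℕ→ℚ m    ∎

  total : ℚ
  total = ℕ→ℚ (a ℕ.* (2 ℕ.+ m)) - ℕ→ℚ ((2 ℕ.+ k) ℕ.* m)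

  y : Fin (sum parts) → ℚ
  y = weight ∘ partSize parts

  Σy≡total : Σℚ y ≡ total
  Σy≡total = begin
    Σℚ y
      ≡⟨ Σ-partSize parts weight ⟩
    1ℚ * - M + (1ℚ * - M + Σ-parts (replicate k 1 ++ replicate a (2 ℕ.+ m)) weight)
      ≡⟨ cong (λ r → 1ℚ * - M + (1ℚ * - M + r)) (trans (Σ-parts-++ (replicate k 1) _ weight)
           (cong₂ _+_ (Σ-parts-replicate k 1 weight) (Σ-parts-replicate a (2 ℕ.+ m) weight))) ⟩
    1ℚ * - M + (1ℚ * - M + (K * (1ℚ * - M) + A * (P * 1ℚ)))
      ≡⟨ solve 4 (λ M K A P →
                    con 1ℚ :* (:- M) :+ (con 1ℚ :* (:- M) :+ (K :* (con 1ℚ :* (:- M)) :+ A :* (P :* con 1ℚ)))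
                    := A :* P :- (con (ℕ→ℚ 2) :+ K) :* M) refl M K A P ⟩
    A * P - (ℕ→ℚ 2 + K) * M
      ≡⟨ cong (λ z → A * P - z * M) (ℕ→ℚ-+ 2 k) ⟨
    A * P - ℕ→ℚ (2 ℕ.+ k) * M
      ≡⟨ cong₂ _-_ (ℕ→ℚ-* a (2 ℕ.+ m)) (ℕ→ℚ-* (2 ℕ.+ k) m) ⟨
    total
      ∎
    where
    M K A P : ℚ
    M = ℕ→ℚ m
    K = ℕ→ℚ k
    A = ℕ→ℚ a
    P = ℕ→ℚ (2 ℕ.+ m)

  constantRows : ∀ u → (distance · y) u ≡ total + ℕ→ℚ m
  constantRows u = ∙-cancelʳ (ℕ→ℚ 2 * y u) _ _ (begin
    (distance · y) u + ℕ→ℚ 2 * y u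
      ≡⟨ ·-distance y u ⟩
    Σℚ y + Σℚ (λ v → if samePart u v then y v else 0ℚ)
      ≡⟨ cong₂ _+_ Σy≡total (Σ-samePart parts weight u) ⟩
    total + ℕ→ℚ s * weight s
      ≡⟨ cong (total +_) (partSize-All weight-balanced u) ⟩
    total + (ℕ→ℚ 2 * weight s + ℕ→ℚ m)
      ≡⟨ solve 3 (λ t w m → t :+ (w :+ m) := (t :+ m) :+ w) refl total (ℕ→ℚ 2 * weight s) (ℕ→ℚ m) ⟩
    total + ℕ→ℚ m + ℕ→ℚ 2 * y u
      ∎)
    where
    s = partSize parts u

  curvatureIndex : ∀ q → q ≢ 0ℚ → total ≢ 0ℚ → q * total ≡ total + ℕ→ℚ m →
                   Connected graph × CurvatureIndexIs graph q
  curvatureIndex q q≢0 total≢0 q*total≡row =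
    connected (s≤s z≤n) isDistance , distance , isDistance ,
    constantRows⇒index distance-sym {y} (total + ℕ→ℚ m) q row≢0 constantRows
                       (trans (cong (q *_) Σy≡total) q*total≡row)
    where
    isDistance : IsDistanceMatrix graph distance
    isDistance = isDistanceMatrix otherPart
    row≢0 : total + ℕ→ℚ m ≢ 0ℚ
    row≢0 = subst (_≢ 0ℚ) q*total≡row (*-≢0 q≢0 total≢0)

clearDenominator : ∀ q → (∃₂ λ Q d → q * ℕ→ℚ (suc Q) ≡ ℕ→ℚ (suc Q ℕ.+ d))
                       ⊎ (∃₂ λ Q e → q * ℕ→ℚ (suc Q) + ℕ→ℚ (suc e) ≡ ℕ→ℚ (suc Q))
clearDenominator q@(mkℚ (ℤ.+ p) Q _) with p ℕ.≤? Q
... | no p≰Q = inj₁ (Q , p ℕ.∸ suc Q ,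
  trans (mkℚ-*-denominator p Q) (cong ℕ→ℚ (≡.sym (m+[n∸m]≡n (≰⇒> p≰Q)))))
... | yes p≤Q = inj₂ (Q , Q ℕ.∸ p , (begin
  q * ℕ→ℚ (suc Q) + ℕ→ℚ (suc (Q ℕ.∸ p))
    ≡⟨ cong (_+ ℕ→ℚ (suc (Q ℕ.∸ p))) (mkℚ-*-denominator p Q) ⟩
  ℕ→ℚ p + ℕ→ℚ (suc (Q ℕ.∸ p))
    ≡⟨ ℕ→ℚ-+ p (suc (Q ℕ.∸ p)) ⟨
  ℕ→ℚ (p ℕ.+ suc (Q ℕ.∸ p))
    ≡⟨ cong ℕ→ℚ (trans (+-suc p (Q ℕ.∸ p)) (cong suc (m+[n∸m]≡n p≤Q))) ⟩
  ℕ→ℚ (suc Q)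
    ∎))
clearDenominator q@(mkℚ ℤ.-[1+ p ] Q _) = inj₂ (Q , p ℕ.+ suc Q , (begin
  q * ℕ→ℚ (suc Q) + ℕ→ℚ (suc p ℕ.+ suc Q)
    ≡⟨ cong₂ _+_ negated (ℕ→ℚ-+ (suc p) (suc Q)) ⟩
  - ℕ→ℚ (suc p) + (ℕ→ℚ (suc p) + ℕ→ℚ (suc Q))
    ≡⟨ solve 2 (λ P Q → :- P :+ (P :+ Q) := Q) refl (ℕ→ℚ (suc p)) (ℕ→ℚ (suc Q)) ⟩
  ℕ→ℚ (suc Q)
    ∎))
  where
  negated : q * ℕ→ℚ (suc Q) ≡ - ℕ→ℚ (suc p)
  negated = trans (solve 2 (λ q D → q :* D := :- ((:- q) :* D)) refl q (ℕ→ℚ (suc Q)))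
                  (cong -_ (mkℚ-*-denominator (suc p) Q))

record Parameters (q : ℚ) : Set where
  field
    m a k   : ℕ
    total≢0 : Family.total m a k ≢ 0ℚ
    balance : q * Family.total m a k ≡ Family.total m a k + ℕ→ℚ m

parameters≥1 : ∀ q Q d → q * ℕ→ℚ (suc Q) ≡ ℕ→ℚ (suc Q ℕ.+ d) → Parameters q
parameters≥1 q Q d qQ≡Q+d = record { m = m ; a = a ; k = a ; total≢0 = total≢0 ; balance = balance }
  where
  m a : ℕ
  m = 2 ℕ.* d
  a = suc Q ℕ.+ m

  total≡2Q : Family.total m a a ≡ ℕ→ℚ (2 ℕ.* suc Q)
  total≡2Q = ℕ→ℚ-difference ((2 ℕ.+ a) ℕ.* m) (2 ℕ.* suc Q) (identity (suc Q) d)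
    where
    identity : ∀ Q d → (Q ℕ.+ 2 ℕ.* d) ℕ.* (2 ℕ.+ 2 ℕ.* d)
                       ≡ (2 ℕ.+ (Q ℕ.+ 2 ℕ.* d)) ℕ.* (2 ℕ.* d) ℕ.+ 2 ℕ.* Q
    identity = solve-∀

  total≢0 : Family.total m a a ≢ 0ℚ
  total≢0 = subst (_≢ 0ℚ) (≡.sym total≡2Q) (ℕ→ℚ-≢0 (2 ℕ.* suc Q))

  balance : q * Family.total m a a ≡ Family.total m a a + ℕ→ℚ m
  balance = begin
    q * Family.total m a a             ≡⟨ cong (q *_) (trans total≡2Q (ℕ→ℚ-* 2 (suc Q))) ⟩
    q * (ℕ→ℚ 2 * ℕ→ℚ (suc Q))          ≡⟨ solve 3 (λ q t Q → q :* (t :* Q) := t :* (q :* Q))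
                                                   refl q (ℕ→ℚ 2) (ℕ→ℚ (suc Q)) ⟩
    ℕ→ℚ 2 * (q * ℕ→ℚ (suc Q))          ≡⟨ cong (ℕ→ℚ 2 *_) qQ≡Q+d ⟩
    ℕ→ℚ 2 * ℕ→ℚ (suc Q ℕ.+ d)          ≡⟨ ℕ→ℚ-* 2 (suc Q ℕ.+ d) ⟨
    ℕ→ℚ (2 ℕ.* (suc Q ℕ.+ d))          ≡⟨ cong ℕ→ℚ (*-distribˡ-+ 2 (suc Q) d) ⟩
    ℕ→ℚ (2 ℕ.* suc Q ℕ.+ m)            ≡⟨ ℕ→ℚ-+ (2 ℕ.* suc Q) m ⟩
    ℕ→ℚ (2 ℕ.* suc Q) + ℕ→ℚ m          ≡⟨ cong (_+ ℕ→ℚ m) total≡2Q ⟨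
    Family.total m a a + ℕ→ℚ m         ∎

parameters<1 : ∀ q Q e → q * ℕ→ℚ (suc Q) + ℕ→ℚ (suc e) ≡ ℕ→ℚ (suc Q) → Parameters q
parameters<1 q Q e qQ+e≡Q = record { m = m ; a = a ; k = k ; total≢0 = total≢0 ; balance = balance }
  where
  m a k : ℕ
  m = 2 ℕ.* suc e
  a = e ℕ.* suc Q ℕ.+ m
  k = suc e ℕ.* suc Q ℕ.+ m

  total≡-2Q : Family.total m a k ≡ - ℕ→ℚ (2 ℕ.* suc Q)
  total≡-2Q = ℕ→ℚ-difference⁻ (a ℕ.* (2 ℕ.+ m)) (2 ℕ.* suc Q) (identity (suc Q) e)
    where
    identity : ∀ Q e → (2 ℕ.+ (suc e ℕ.* Q ℕ.+ 2 ℕ.* suc e)) ℕ.* (2 ℕ.* suc e)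
                       ≡ (e ℕ.* Q ℕ.+ 2 ℕ.* suc e) ℕ.* (2 ℕ.+ 2 ℕ.* suc e) ℕ.+ 2 ℕ.* Q
    identity = solve-∀

  total≢0 : Family.total m a k ≢ 0ℚ
  total≢0 total≡0 = ℕ→ℚ-≢0 (2 ℕ.* suc Q) (neg-injective (trans (≡.sym total≡-2Q) total≡0))

  T Q′ E : ℚ
  T  = ℕ→ℚ 2
  Q′ = ℕ→ℚ (suc Q)
  E  = ℕ→ℚ (suc e)

  balance : q * Family.total m a k ≡ Family.total m a k + ℕ→ℚ m
  balance = begin
    q * Family.total m a k          ≡⟨ cong (λ t → q * t) (trans total≡-2Q (cong -_ (ℕ→ℚ-* 2 (suc Q)))) ⟩
    q * - (T * Q′)                  ≡⟨ solve 4 (λ q T Q E → q :* (:- (T :* Q)) := T :* E :- T :* (q :* Q :+ E))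
                                                refl q T Q′ E ⟩
    T * E - T * (q * Q′ + E)        ≡⟨ cong (λ z → T * E - T * z) qQ+e≡Q ⟩
    T * E - T * Q′                  ≡⟨ solve 3 (λ T Q E → T :* E :- T :* Q := :- (T :* Q) :+ T :* E)
                                                refl T Q′ E ⟩
    - (T * Q′) + T * E              ≡⟨ cong₂ (λ x z → - x + z) (ℕ→ℚ-* 2 (suc Q)) (ℕ→ℚ-* 2 (suc e)) ⟨
    - ℕ→ℚ (2 ℕ.* suc Q) + ℕ→ℚ m     ≡⟨ cong (_+ ℕ→ℚ m) total≡-2Q ⟨
    Family.total m a k + ℕ→ℚ m      ∎

parameters : ∀ q → Parameters q
parameters q with clearDenominator q
... | inj₁ (Q , d , qQ≡Q+d)  = parameters≥1 q Q d qQ≡Q+d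
... | inj₂ (Q , e , qQ+e≡Q) = parameters<1 q Q e qQ+e≡Q

K₁ : Graph
K₁ = record { n = 1 ; adj = λ _ _ → false ; sym = λ _ _ → refl ; irrefl = λ _ () }

K₁-distance : IsDistanceMatrix K₁ (λ _ _ → 0)
K₁-distance zero zero = nil zero , λ _ ()

K₁-index : IndexOfMatrixIs {1} (λ _ _ → 0) 0ℚ
K₁-index = inj₁ exceptional , λ c → mk⇔ (onlyIf c) (if c)
  where
  ·-zero : ∀ x i → ((λ _ _ → 0) · x) i ≡ 0ℚ
  ·-zero x i = trans (+-identityʳ _) (*-zeroˡ (x zero))

  exceptional : DistanceExceptional {1} (λ _ _ → 0)
  exceptional (x , Dx≡1) = 1≢0 (trans (≡.sym (Dx≡1 zero)) (·-zero x zero))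

  onlyIf : ∀ c → InX {1} (λ _ _ → 0) (λ _ → c) → c ≡ 0ℚ
  onlyIf c (x , _ , Dx≡c) = trans (≡.sym (Dx≡c zero)) (·-zero x zero)

  if : ∀ c → c ≡ 0ℚ → InX {1} (λ _ _ → 0) (λ _ → c)
  if c refl = const 1ℚ , +-identityʳ 1ℚ , ·-zero (const 1ℚ)

theorem5p2 : (q : ℚ) → Σ Graph (λ G → Connected G × CurvatureIndexIs G q)
theorem5p2 q with q ≟ 0ℚ
... | yes refl = K₁ , connected (s≤s z≤n) K₁-distance , (λ _ _ → 0) , K₁-distance , K₁-index
... | no  q≢0  = graph , curvatureIndex q q≢0 total≢0 balance
  where
  open Parameters (parameters q)
  open Family m a k
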